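{- No pentagram spider is a willow.
   Context: A pentagram spider is a 10-vertex graph $G$ having a perfect matching $M$ such that the graph obtained from $G$ by deleting the edges of $M$ has a component isomorphic to $K_5$ (other edges among the remaining vertices are allowed). For a positive integer $n$, a graph $G$ is an $n$-willow if there exists an oriented tree $T$ with $V(G)\subseteq V(T)$ such that for all distinct $u,v\in V(G)$, $u$ and $v$ are adjacent in $G$ if and only if $T$ has a directed path from $u$ to $v$ or from $v$ to $u$ whose length is not a multiple of $n$. A willow is a graph that is an $n$-willow for some positive integer $n$. -}

module Defs where

open import Data.Nat using (ℕ; zero; suc; NonZero)
open import Data.Nat.Divisibility using (_∣_)
open import Data.Fin using (Fin; zero; suc; fromℕ; inject₁)
open import Data.Bool using (Bool; true; false; T; _∨_)
open import Data.Product using (Σ; Σ-syntax; ∃; ∃-syntax; _×_; _,_)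
open import Data.Sum using (_⊎_)
open import Data.Unit using (⊤)
open import Data.Empty using (⊥)
open import Relation.Nullary using (¬_)
open import Relation.Binary.PropositionalEquality using (_≡_; _≢_)
open import Function.Definitions using (Injective)
open import Function.Bundles using (_⇔_)

record Graph (n : ℕ) : Set where
  field
    adj    : Fin n → Fin n → Bool
    sym    : ∀ u v → adj u v ≡ adj v u
    irrefl : ∀ v → adj v v ≡ false

open Graph public

Edge : ∀ {n} → Graph n → Fin n → Fin n → Set
Edge G u v = T (adj G u v)

data ReachIn {n : ℕ} (E : Fin n → Fin n → Set) (S : Fin n → Set)
       : Fin n → Fin n → Set where
  here : ∀ {u} → ReachIn E S u u
  step : ∀ {u w v} → E u w → S w → ReachIn E S w v → ReachIn E S u v

-- S is (the vertex set of) a connected component of the graph with edge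
-- relation E: nonempty, connected inside S, and no edge leaves S
-- (i.e. S is a maximal connected set of vertices).
IsComponent : ∀ {n} → (Fin n → Fin n → Set) → (Fin n → Set) → Set
IsComponent {n} E S =
  (∃[ v ] S v)
  × (∀ u v → S u → S v → ReachIn E S u v)
  × (∀ u v → S u → E u v → S v)

InducedIsoK5 : ∀ {n} → (Fin n → Fin n → Set) → (Fin n → Set) → Set
InducedIsoK5 {n} E S =
  Σ[ f ∈ (Fin 5 → Fin n) ]
    (∀ i → S (f i))
    × Injective _≡_ _≡_ f
    × (∀ v → S v → ∃[ i ] f i ≡ v)
    × (∀ i j → E (f i) (f j) ⇔ (i ≢ j))

-- A perfect matching, given by the partner function m
-- (the matching is the edge set { v (m v) }).
IsPerfectMatching : ∀ {n} → Graph n → (Fin n → Fin n) → Set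
IsPerfectMatching G m =
  (∀ v → m (m v) ≡ v) × (∀ v → m v ≢ v) × (∀ v → Edge G v (m v))

EdgeMinus : ∀ {n} → Graph n → (Fin n → Fin n) → Fin n → Fin n → Set
EdgeMinus G m u v = Edge G u v × (v ≢ m u)

PentagramSpider : Graph 10 → Set₁
PentagramSpider G =
  Σ[ m ∈ (Fin 10 → Fin 10) ] IsPerfectMatching G m ×
    (Σ[ S ∈ (Fin 10 → Set) ]
       IsComponent (EdgeMinus G m) S × InducedIsoK5 (EdgeMinus G m) S)

Cycle : ∀ {k} → (Fin k → Fin k → Set) → Set
Cycle {k} E =
  Σ[ m ∈ ℕ ] Σ[ c ∈ (Fin (suc (suc (suc m))) → Fin k) ]
    Injective _≡_ _≡_ c
    × (∀ (i : Fin (suc (suc m))) → E (c (inject₁ i)) (c (suc i)))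
    × E (c (fromℕ (suc (suc m)))) (c zero)

record OrientedTree (k : ℕ) : Set where
  field
    arc       : Fin k → Fin k → Bool
    noLoop    : ∀ v → arc v v ≡ false
    noDigon   : ∀ u v → T (arc u v) → T (arc v u) → ⊥
    connected : ∀ u v → ReachIn (λ x y → T (arc x y ∨ arc y x)) (λ _ → ⊤) u v
    acyclic   : ¬ Cycle (λ x y → T (arc x y ∨ arc y x))

open OrientedTree public

DirPath : ∀ {k} → OrientedTree k → Fin k → Fin k → ℕ → Set
DirPath {k} Tr u v ℓ =
  Σ[ p ∈ (Fin (suc ℓ) → Fin k) ]
    Injective _≡_ _≡_ p
    × p zero ≡ u
    × p (fromℕ ℓ) ≡ v
    × (∀ (i : Fin ℓ) → T (arc Tr (p (inject₁ i)) (p (suc i))))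

IsWillowWith : ∀ {N} → Graph N → ℕ → Set
IsWillowWith {N} G n =
  Σ[ k ∈ ℕ ] Σ[ Tr ∈ OrientedTree k ] Σ[ ι ∈ (Fin N → Fin k) ]
    Injective _≡_ _≡_ ι
    × (∀ u v → u ≢ v →
         Edge G u v ⇔
         (Σ[ ℓ ∈ ℕ ] (DirPath Tr (ι u) (ι v) ℓ ⊎ DirPath Tr (ι v) (ι u) ℓ)
                     × ¬ (n ∣ ℓ)))

Willow : ∀ {N} → Graph N → Set
Willow G = Σ[ n ∈ ℕ ] NonZero n × IsWillowWith G n

-- In an n-willow the images a₀,…,a₄ of the K₅ are pairwise joined by directed
-- tree paths of length ≢ 0 (mod n), and since an oriented tree has no directed
-- cycles this relation is a linear order on the clique. The matching partner b
-- of a clique vertex aᵢ is adjacent to aᵢ and to no other aⱼ, since otherwise it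
-- would lie in the K₅ component. If the path between b and aᵢ runs from b and
-- aᵢ < aⱼ < aₖ, then the paths b → aⱼ and b → aₖ have length ≡ 0 (mod n), hence
-- so has the path aⱼ → aₖ, which is absurd; dually if it runs towards b. So each
-- clique vertex has at most one vertex above it or at most one below it, which
-- fails for the middle one of five.
module Submission where

open import Defs hiding (sym)
open import Data.Nat using (ℕ; zero; suc; _+_; _≤_; s≤s; s≤s⁻¹; z≤n)
open import Data.Nat.Properties using (m+n≡0⇒m≡0; +-comm; <-irrefl; ≤-trans; ≤-reflexive; 1+n≰n)
open import Data.Nat.Divisibility using (_∣_; _∣?_; _∣0; ∣m+n∣m⇒∣n)
open import Data.Fin using (Fin; zero; suc; fromℕ; inject₁; inject≤; toℕ; fromℕ<; _≟_; join; splitAt)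
open import Data.Fin.Properties using (toℕ<n; inject≤-injective; suc-injective; fromℕ<-injective; splitAt-join; injective⇒≤)
open import Data.Fin.Subset using (Subset; _∈_; _⊂_; ∣_∣)
open import Data.Fin.Subset.Properties using (nonempty?; Empty-unique; ∣⊥∣≡0; ∣⁅x⁆∣≡1; x∈⁅y⁆⇔x≡y; p⊆q⇒∣p∣≤∣q∣; p⊂q⇒∣p∣<∣q∣)
open import Data.Vec using (tabulate)
open import Data.Vec.Properties using (lookup∘tabulate; lookup⇒[]=; []=⇒lookup)
open import Data.Bool using (T; _∨_)
open import Data.Bool.Properties using (T-∨)
open import Data.Product using (Σ-syntax; ∃-syntax; _×_; _,_; proj₁; proj₂)
open import Data.Sum using (_⊎_; inj₁; inj₂)
open import Data.Sum.Properties using (inj₁-injective; inj₂-injective)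
open import Data.Empty using (⊥-elim)
open import Function using (_∘_; _⇔_; Equivalence)
open import Function.Definitions using (Injective)
open import Level using (0ℓ)
open import Relation.Nullary using (¬_; yes; no; does; contradiction)
open import Relation.Nullary.Decidable using (dec-true)
open import Relation.Unary using (Pred; Decidable)
open import Relation.Binary using (Rel; IsStrictTotalOrder; Trichotomous; tri<; tri≈; tri>)
open import Relation.Binary.PropositionalEquality

inject≤-inject₁ : ∀ {m n} (i : Fin m) (le : suc m ≤ suc n) →
                  inject≤ (inject₁ i) le ≡ inject₁ (inject≤ i (s≤s⁻¹ le))
inject≤-inject₁ zero    (s≤s (s≤s _))  = refl
inject≤-inject₁ (suc i) (s≤s (s≤s le)) = cong suc (inject≤-inject₁ i (s≤s le))

inject≤-fromℕ-toℕ : ∀ {n} (i : Fin (suc n)) .(le : suc (toℕ i) ≤ suc n) →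
                    inject≤ (fromℕ (toℕ i)) le ≡ i
inject≤-fromℕ-toℕ {n = _}     zero    _  = refl
inject≤-fromℕ-toℕ {n = suc _} (suc i) le = cong suc (inject≤-fromℕ-toℕ i (s≤s⁻¹ le))

module _ {k : ℕ} (Tr : OrientedTree k) where

  private
    variable
      x y z : Fin k
      ℓ ℓ′ : ℕ

    Arc : Fin k → Fin k → Set
    Arc x y = T (arc Tr x y)

    arc⇒edge : Arc x y → T (arc Tr x y ∨ arc Tr y x)
    arc⇒edge = Equivalence.from T-∨ ∘ inj₁

  DirPath⇒¬reverseArc : DirPath Tr x y ℓ → ¬ Arc y x
  DirPath⇒¬reverseArc {x} {ℓ = zero} (_ , _ , p₀ , pℓ , _) yx =
    subst T (noLoop Tr x) (subst (λ v → Arc v x) (trans (sym pℓ) p₀) yx)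
  DirPath⇒¬reverseArc {ℓ = suc zero} (_ , _ , p₀ , pℓ , arcs) yx =
    noDigon Tr _ _ (subst₂ Arc p₀ pℓ (arcs zero)) yx
  DirPath⇒¬reverseArc {ℓ = suc (suc ℓ)} (p , p-inj , p₀ , pℓ , arcs) yx =
    acyclic Tr (ℓ , p , p-inj , arc⇒edge ∘ arcs , arc⇒edge (subst₂ Arc (sym pℓ) (sym p₀) yx))

  DirPath-prefix : (P : DirPath Tr x y ℓ) (t : Fin (suc ℓ)) → DirPath Tr x (proj₁ P t) (toℕ t)
  DirPath-prefix (p , p-inj , p₀ , _ , arcs) t =
      (λ a → p (inject≤ a t<))
    , (λ eq → inject≤-injective t< t< _ _ (p-inj eq))
    , p₀
    , cong p (inject≤-fromℕ-toℕ t t<)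
    , λ i → subst (λ v → Arc v (p (inject≤ (suc i) t<))) (cong p (sym (inject≤-inject₁ i t<))) (arcs (inject≤ i (s≤s⁻¹ t<)))
    where t< = toℕ<n t

  DirPath-tail : (P : DirPath Tr x y (suc ℓ)) → DirPath Tr (proj₁ P (suc zero)) y ℓ
  DirPath-tail (p , p-inj , _ , pℓ , arcs) = p ∘ suc , suc-injective ∘ p-inj , refl , pℓ , arcs ∘ suc

  DirPath-∷ : Arc x y → DirPath Tr y z ℓ → DirPath Tr x z (suc ℓ)
  DirPath-∷ {x} {y} {ℓ = ℓ} xy Q@(q , q-inj , q₀ , qℓ , arcs) = r , r-inj , refl , qℓ , r-arcs
    where
    r : Fin (suc (suc ℓ)) → Fin k
    r zero    = x
    r (suc i) = q i

    x∉Q : ∀ j → x ≢ q j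
    x∉Q j x≡qj = DirPath⇒¬reverseArc (DirPath-prefix Q j) (subst (λ v → Arc v y) x≡qj xy)

    r-inj : Injective _≡_ _≡_ r
    r-inj {zero}  {zero}  _  = refl
    r-inj {zero}  {suc j} eq = contradiction eq (x∉Q j)
    r-inj {suc i} {zero}  eq = contradiction (sym eq) (x∉Q i)
    r-inj {suc i} {suc j} eq = cong suc (q-inj eq)

    r-arcs : ∀ (i : Fin (suc ℓ)) → Arc (r (inject₁ i)) (r (suc i))
    r-arcs zero    = subst (Arc x) (sym q₀) xy
    r-arcs (suc i) = arcs i

  DirPath-++ : DirPath Tr x y ℓ → DirPath Tr y z ℓ′ → DirPath Tr x z (ℓ + ℓ′)
  DirPath-++ {ℓ = zero} {z = z} {ℓ′ = ℓ′} (_ , _ , p₀ , pℓ , _) Q =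
    subst (λ v → DirPath Tr v z ℓ′) (trans (sym pℓ) p₀) Q
  DirPath-++ {ℓ = suc _} P@(_ , _ , p₀ , _ , arcs) Q =
    DirPath-∷ (subst (λ v → Arc v _) p₀ (arcs zero)) (DirPath-++ (DirPath-tail P) Q)

  DirPath-closed⇒0 : DirPath Tr x x ℓ → ℓ ≡ 0
  DirPath-closed⇒0 {ℓ = zero}  _ = refl
  DirPath-closed⇒0 {ℓ = suc _} (_ , p-inj , p₀ , pℓ , _) with p-inj (trans p₀ (sym pℓ))
  ... | ()

  DirPath-return⇒0 : DirPath Tr x y ℓ → DirPath Tr y x ℓ′ → ℓ ≡ 0
  DirPath-return⇒0 {ℓ = ℓ} P Q = m+n≡0⇒m≡0 ℓ (DirPath-closed⇒0 (DirPath-++ P Q))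

subset : ∀ {n p} {P : Pred (Fin n) p} → Decidable P → Subset n
subset P? = tabulate (does ∘ P?)

module _ {n p} {P : Pred (Fin n) p} (P? : Decidable P) where

  ∈subset⁺ : ∀ {x} → P x → x ∈ subset P?
  ∈subset⁺ {x} px = lookup⇒[]= x _ (trans (lookup∘tabulate (does ∘ P?) x) (dec-true (P? x) px))

  ∈subset⁻ : ∀ {x} → x ∈ subset P? → P x
  ∈subset⁻ {x} x∈ with P? x | trans (sym (lookup∘tabulate (does ∘ P?) x)) ([]=⇒lookup x∈)
  ... | yes px | _ = px
  ... | no  _  | ()

unique⇒∣p∣≤1 : ∀ {n} {p : Subset n} → (∀ {x y} → x ∈ p → y ∈ p → x ≡ y) → ∣ p ∣ ≤ 1
unique⇒∣p∣≤1 {n} {p} unique with nonempty? p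
... | yes (x , x∈p) =
  ≤-trans (p⊆q⇒∣p∣≤∣q∣ (λ y∈p → Equivalence.from x∈⁅y⁆⇔x≡y (unique y∈p x∈p))) (≤-reflexive (∣⁅x⁆∣≡1 x))
... | no  empty = ≤-trans (≤-reflexive (trans (cong ∣_∣ (Empty-unique empty)) (∣⊥∣≡0 n))) z≤n

module _ {n ℓ} (_≺_ : Rel (Fin n) ℓ) where

  TwoAbove TwoBelow NearEnd : Fin n → Set ℓ
  TwoAbove i = ∃[ j ] ∃[ k ] i ≺ j × j ≺ k
  TwoBelow i = ∃[ j ] ∃[ k ] j ≺ k × k ≺ i
  NearEnd  i = ¬ TwoAbove i ⊎ ¬ TwoBelow i

module _ {n ℓ} {_≺_ : Rel (Fin n) ℓ} (sto : IsStrictTotalOrder _≡_ _≺_) where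

  open IsStrictTotalOrder sto using (compare; _<?_) renaming (trans to ≺-trans; irrefl to ≺-irrefl)

  private
    above below : Fin n → Subset n
    above i = subset (i <?_)
    below i = subset (_<? i)

    separating⇒injective : {A : Set} (h : Fin n → A) → (∀ {i j} → i ≺ j → h i ≢ h j) → Injective _≡_ _≡_ h
    separating⇒injective h separates {i} {j} eq with compare i j
    ... | tri< i≺j _   _   = contradiction eq (separates i≺j)
    ... | tri≈ _   i≡j _   = i≡j
    ... | tri> _   _   j≺i = contradiction (sym eq) (separates j≺i)

    ∣above∣-injective : Injective _≡_ _≡_ (∣_∣ ∘ above)
    ∣above∣-injective = separating⇒injective _ λ i≺j eq → <-irrefl (sym eq) (p⊂q⇒∣p∣<∣q∣ (shrinks i≺j))
      where
      shrinks : ∀ {i j} → i ≺ j → above j ⊂ above i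
      shrinks {i} {j} i≺j =
        (λ x∈ → ∈subset⁺ (i <?_) (≺-trans i≺j (∈subset⁻ (j <?_) x∈))) ,
        j , ∈subset⁺ (i <?_) i≺j , ≺-irrefl refl ∘ ∈subset⁻ (j <?_)

    ∣below∣-injective : Injective _≡_ _≡_ (∣_∣ ∘ below)
    ∣below∣-injective = separating⇒injective _ λ i≺j eq → <-irrefl eq (p⊂q⇒∣p∣<∣q∣ (grows i≺j))
      where
      grows : ∀ {i j} → i ≺ j → below i ⊂ below j
      grows {i} {j} i≺j =
        (λ x∈ → ∈subset⁺ (_<? j) (≺-trans (∈subset⁻ (_<? i) x∈) i≺j)) ,
        i , ∈subset⁺ (_<? j) i≺j , ≺-irrefl refl ∘ ∈subset⁻ (_<? i)

    ¬TwoAbove⇒∣above∣≤1 : ∀ {i} → ¬ TwoAbove _≺_ i → ∣ above i ∣ ≤ 1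
    ¬TwoAbove⇒∣above∣≤1 {i} ¬two = unique⇒∣p∣≤1 unique
      where
      unique : ∀ {x y} → x ∈ above i → y ∈ above i → x ≡ y
      unique {x} {y} x∈ y∈ with compare x y
      ... | tri< x≺y _   _   = ⊥-elim (¬two (x , y , ∈subset⁻ (i <?_) x∈ , x≺y))
      ... | tri≈ _   x≡y _   = x≡y
      ... | tri> _   _   y≺x = ⊥-elim (¬two (y , x , ∈subset⁻ (i <?_) y∈ , y≺x))

    ¬TwoBelow⇒∣below∣≤1 : ∀ {i} → ¬ TwoBelow _≺_ i → ∣ below i ∣ ≤ 1
    ¬TwoBelow⇒∣below∣≤1 {i} ¬two = unique⇒∣p∣≤1 unique
      where
      unique : ∀ {x y} → x ∈ below i → y ∈ below i → x ≡ y
      unique {x} {y} x∈ y∈ with compare x y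
      ... | tri< x≺y _   _   = ⊥-elim (¬two (x , y , x≺y , ∈subset⁻ (_<? i) y∈))
      ... | tri≈ _   x≡y _   = x≡y
      ... | tri> _   _   y≺x = ⊥-elim (¬two (y , x , y≺x , ∈subset⁻ (_<? i) x∈))

    -- Elements near the bottom are told apart by the size of their up-set,
    -- those near the top by the size of their down-set.
    code : (i : Fin n) → NearEnd _≺_ i → Fin 2 ⊎ Fin 2
    code i (inj₁ ¬above) = inj₁ (fromℕ< (s≤s (¬TwoAbove⇒∣above∣≤1 ¬above)))
    code i (inj₂ ¬below) = inj₂ (fromℕ< (s≤s (¬TwoBelow⇒∣below∣≤1 ¬below)))

    code-injective : ∀ {i j} (eᵢ : NearEnd _≺_ i) (eⱼ : NearEnd _≺_ j) → code i eᵢ ≡ code j eⱼ → i ≡ j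
    code-injective (inj₁ _) (inj₁ _) eq = ∣above∣-injective (fromℕ<-injective _ _ _ _ (inj₁-injective eq))
    code-injective (inj₂ _) (inj₂ _) eq = ∣below∣-injective (fromℕ<-injective _ _ _ _ (inj₂-injective eq))

  allNearEnd⇒n≤4 : (∀ i → NearEnd _≺_ i) → n ≤ 4
  allNearEnd⇒n≤4 nearEnd = injective⇒≤ {f = λ i → join 2 2 (code i (nearEnd i))} λ eq →
    code-injective (nearEnd _) (nearEnd _)
      (trans (sym (splitAt-join 2 2 _)) (trans (cong (splitAt 2) eq) (splitAt-join 2 2 _)))

Edge-sym : ∀ {N} (G : Graph N) {u v} → Edge G u v → Edge G v u
Edge-sym G {u} {v} = subst T (Graph.sym G u v)

AttachedAt : ∀ {N K} → Graph N → (Fin K → Fin N) → Fin N → Fin K → Set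
AttachedAt G f w i = (∀ j → f j ≢ w) × Edge G w (f i) × (∀ j → j ≢ i → ¬ Edge G w (f j))

module _ {N n k} (G : Graph N) (Tr : OrientedTree k) (ι : Fin N → Fin k)
  (adjacent⇔ : ∀ u v → u ≢ v →
    Edge G u v ⇔ (Σ[ ℓ ∈ ℕ ] (DirPath Tr (ι u) (ι v) ℓ ⊎ DirPath Tr (ι v) (ι u) ℓ) × ¬ (n ∣ ℓ)))
  where

  private
    positive : ∀ {ℓ} → ¬ (n ∣ ℓ) → ℓ ≢ 0
    positive ¬n∣ℓ refl = ¬n∣ℓ (n ∣0)

  nonadjacent⇒n∣ : ∀ {u v ℓ} → u ≢ v → ¬ Edge G u v →
                   DirPath Tr (ι u) (ι v) ℓ ⊎ DirPath Tr (ι v) (ι u) ℓ → n ∣ ℓ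
  nonadjacent⇒n∣ {u} {v} {ℓ} u≢v u≁v path with n ∣? ℓ
  ... | yes n∣ℓ = n∣ℓ
  ... | no ¬n∣ℓ = contradiction (Equivalence.from (adjacent⇔ u v u≢v) (ℓ , path , ¬n∣ℓ)) u≁v

  module _ {K} (f : Fin K → Fin N) (f-injective : Injective _≡_ _≡_ f)
    (clique : ∀ {i j} → i ≢ j → Edge G (f i) (f j)) where

    private
      a : Fin K → Fin k
      a = ι ∘ f

    _≺_ : Rel (Fin K) 0ℓ
    i ≺ j = ∃[ ℓ ] DirPath Tr (a i) (a j) ℓ × ¬ (n ∣ ℓ)

    ≺-irrefl : ∀ {i} → ¬ i ≺ i
    ≺-irrefl (_ , p , ¬n∣) = positive ¬n∣ (DirPath-closed⇒0 Tr p)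

    ≺-asym : ∀ {i j} → i ≺ j → ¬ j ≺ i
    ≺-asym (_ , p , ¬n∣) (_ , q , _) = positive ¬n∣ (DirPath-return⇒0 Tr p q)

    ≺⇒≢ : ∀ {i j} → i ≺ j → i ≢ j
    ≺⇒≢ i≺j refl = ≺-irrefl i≺j

    ≺-connex : ∀ {i j} → i ≢ j → i ≺ j ⊎ j ≺ i
    ≺-connex {i} {j} i≢j with Equivalence.to (adjacent⇔ (f i) (f j) (i≢j ∘ f-injective)) (clique i≢j)
    ... | ℓ , inj₁ p , ¬n∣ = inj₁ (ℓ , p , ¬n∣)
    ... | ℓ , inj₂ p , ¬n∣ = inj₂ (ℓ , p , ¬n∣)

    ≺-trans : ∀ {i j l} → i ≺ j → j ≺ l → i ≺ l
    ≺-trans {i} {j} {l} i≺j@(_ , p , ¬n∣) j≺l@(_ , q , _) with i ≟ l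
    ... | yes refl = ⊥-elim (≺-asym i≺j j≺l)
    ... | no i≢l with ≺-connex i≢l
    ...   | inj₁ i≺l          = i≺l
    ...   | inj₂ (_ , r , _) = ⊥-elim (positive ¬n∣ (DirPath-return⇒0 Tr p (DirPath-++ Tr q r)))

    ≺-compare : Trichotomous _≡_ _≺_
    ≺-compare i j with i ≟ j
    ... | yes refl = tri≈ ≺-irrefl refl ≺-irrefl
    ... | no i≢j with ≺-connex i≢j
    ...   | inj₁ i≺j = tri< i≺j i≢j (≺-asym i≺j)
    ...   | inj₂ j≺i = tri> (≺-asym j≺i) i≢j j≺i

    ≺-isStrictTotalOrder : IsStrictTotalOrder _≡_ _≺_
    ≺-isStrictTotalOrder = record
      { isStrictPartialOrder = record
        { isEquivalence = isEquivalence
        ; irrefl        = λ { refl → ≺-irrefl }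
        ; trans         = ≺-trans
        ; <-resp-≈      = resp₂ _≺_
        }
      ; compare = ≺-compare
      }

    module _ {w i} (attached : AttachedAt G f w i) where

      private
        outside : ∀ j → f j ≢ w
        outside = proj₁ attached

        nonadjacent-away : ∀ {j ℓ} → j ≢ i →
                           DirPath Tr (ι w) (a j) ℓ ⊎ DirPath Tr (a j) (ι w) ℓ → n ∣ ℓ
        nonadjacent-away {j} j≢i = nonadjacent⇒n∣ (outside j ∘ sym) (proj₂ (proj₂ attached) j j≢i)

      pathFrom-attached⇒¬TwoAbove : ∀ {d} → DirPath Tr (ι w) (a i) d → ¬ TwoAbove _≺_ i
      pathFrom-attached⇒¬TwoAbove w⇝aᵢ (j , l , i≺j@(_ , p , _) , (_ , q , ¬n∣)) =
        ¬n∣ (∣m+n∣m⇒∣n (nonadjacent-away (≺⇒≢ (≺-trans i≺j (_ , q , ¬n∣)) ∘ sym) (inj₁ (DirPath-++ Tr w⇝aⱼ q)))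
                       (nonadjacent-away (≺⇒≢ i≺j ∘ sym) (inj₁ w⇝aⱼ)))
        where w⇝aⱼ = DirPath-++ Tr w⇝aᵢ p

      pathTo-attached⇒¬TwoBelow : ∀ {d} → DirPath Tr (a i) (ι w) d → ¬ TwoBelow _≺_ i
      pathTo-attached⇒¬TwoBelow {d} aᵢ⇝w (j , l , j≺l@(ℓ , q , ¬n∣) , l≺i@(ℓ′ , r , _)) =
        ¬n∣ (∣m+n∣m⇒∣n (subst (n ∣_) (+-comm ℓ (ℓ′ + d)) (nonadjacent-away (≺⇒≢ (≺-trans j≺l l≺i)) (inj₂ (DirPath-++ Tr q aₗ⇝w))))
                       (nonadjacent-away (≺⇒≢ l≺i) (inj₂ aₗ⇝w)))
        where aₗ⇝w = DirPath-++ Tr r aᵢ⇝w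

      attached⇒nearEnd : NearEnd _≺_ i
      attached⇒nearEnd with Equivalence.to (adjacent⇔ w (f i) (outside i ∘ sym)) (proj₁ (proj₂ attached))
      ... | _ , inj₁ w⇝aᵢ , _ = inj₁ (pathFrom-attached⇒¬TwoAbove w⇝aᵢ)
      ... | _ , inj₂ aᵢ⇝w , _ = inj₂ (pathTo-attached⇒¬TwoBelow aᵢ⇝w)

module _ {N} (G : Graph N) {m : Fin N → Fin N}
  (m-involutive : ∀ v → m (m v) ≡ v) (m-fixfree : ∀ v → m v ≢ v) (m-edge : ∀ v → Edge G v (m v))
  {S : Fin N → Set} (S-closed : ∀ u v → S u → EdgeMinus G m u v → S v)
  {f : Fin 5 → Fin N} (f∈S : ∀ i → S (f i)) (f-injective : Injective _≡_ _≡_ f)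
  (f-onto : ∀ v → S v → ∃[ i ] f i ≡ v) (f-complete : ∀ i j → EdgeMinus G m (f i) (f j) ⇔ (i ≢ j))
  where

  private
    m-injective : Injective _≡_ _≡_ m
    m-injective {u} {v} eq = trans (sym (m-involutive u)) (trans (cong m eq) (m-involutive v))

  partner∉S : ∀ i → ¬ S (m (f i))
  partner∉S i partner∈S with f-onto _ partner∈S
  ... | j , fj≡partner with i ≟ j
  ...   | yes refl = m-fixfree (f i) (sym fj≡partner)
  ...   | no  i≢j  = proj₂ (Equivalence.from (f-complete i j) i≢j) fj≡partner

  partner-attached : ∀ i → AttachedAt G f (m (f i)) i
  partner-attached i =
      (λ j fj≡partner → partner∉S i (subst S fj≡partner (f∈S j)))
    , Edge-sym G (m-edge (f i))
    , λ j j≢i partner~fj → partner∉S i (S-closed (f j) (m (f i)) (f∈S j)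
        (Edge-sym G partner~fj , λ eq → j≢i (f-injective (m-injective (sym eq)))))

proposition9p1 : (G : Graph 10) → PentagramSpider G → ¬ Willow G
proposition9p1 G (m , (m-involutive , m-fixfree , m-edge) , S , (_ , _ , S-closed) , f , f∈S , f-injective , f-onto , f-complete)
                 (n , _ , k , Tr , ι , _ , adjacent⇔) =
  1+n≰n (allNearEnd⇒n≤4 (≺-isStrictTotalOrder G Tr ι adjacent⇔ f f-injective clique) λ i →
    attached⇒nearEnd G Tr ι adjacent⇔ f f-injective clique
      (partner-attached G m-involutive m-fixfree m-edge S-closed f∈S f-injective f-onto f-complete i))
  where
  clique : ∀ {i j} → i ≢ j → Edge G (f i) (f j)
  clique {i} {j} = proj₁ ∘ Equivalence.from (f-complete i j)
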